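{- For every integer $k\ge1$, the $k$-piece ranking function template, written in conjunctive normal form with the conjuncts $\delta>0$; $\ g_i(x)<0\vee g_j(x')<0\vee f_j(x')<f_i(x)-\delta$ (for all $i,j\in\{1,\ldots,k\}$); $\ f_i(x)>0$ ($i=1,\ldots,k$); and $\ \bigvee_{i=1}^k g_i(x)\ge0$, over function symbols $F=\{f_1,\ldots,f_k,g_1,\ldots,g_k\}$ and variables $D=\{\delta\}$, has degree $2k^2-1$.
   Context: Each atom has the form $\sum_{f\in F}(\alpha_f f(x)+\beta_f f(x'))+\sum_{d\in D}\gamma_d d\rhd0$ ($\rhd\in\{\ge,>\}$); a symbol or variable occurs in an atom iff its coefficient there is nonzero. Atom occurrences in the CNF are distinguished even if the same atom occurs in several places. The dependency graph $G_T$ of a template $T$ has node set $D\cup F$ and an undirected edge between $u,v$ (including $u=v$) iff some atom of $T$ contains both; $[u]$ is the connected component of $u$. A coloring $\eta$ maps each atom occurrence to one of white (uncolored), red, blue. The coloring graph $G_\eta$ is the directed graph on the connected components of $G_T$ with an edge $([u],[v])$ iff for some conjunct, $u$ occurs in a red occurrence and $v$ occurs in a blue occurrence of that conjunct. $\eta$ is suitable iff (a) every conjunct contains exactly one red occurrence; (b) for all $u,v$ occurring in two different blue occurrences, there is no path between $u$ and $v$ in $G_T$; (c) $G_\eta$ is acyclic. $\deg_T(\eta)$ is the number of uncolored occurrences, and the degree of $T$ is the minimum of $\deg_T(\eta)$ over all suitable colorings $\eta$. -}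

module Defs where

open import Data.Nat using (ℕ; zero; suc; _+_; _≤_)
open import Data.Integer using (ℤ; 0ℤ; 1ℤ; -1ℤ) renaming (_+_ to _ℤ+_)
open import Data.Fin using (Fin; zero; suc)
open import Data.Fin.Properties using () renaming (_≟_ to _≟F_)
open import Data.List using (List; []; _∷_; _++_; length; lookup; map; concatMap; allFin)
open import Data.Sum using (_⊎_; inj₁; inj₂)
open import Data.Sum.Properties using (≡-dec)
open import Data.Unit using (⊤; tt)
open import Data.Bool using (Bool; true; false; if_then_else_)
open import Data.Product using (Σ; Σ-syntax; ∃; _×_; _,_)
open import Relation.Nullary using (¬_; does)
open import Relation.Binary.Definitions using (DecidableEquality)
open import Relation.Binary.PropositionalEquality using (_≡_; _≢_)
open import Relation.Binary.Construct.Closure.ReflexiveTransitive using (Star)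
open import Relation.Binary.Construct.Closure.Transitive using (TransClosure)

-- Atoms  Σ_f (α_f f(x) + β_f f(x')) + Σ_d γ_d d ▷ 0,  ▷ ∈ {≥, >}
-- over function-symbol index type F and variable index type D.

data Rel▷ : Set where
  ge gt : Rel▷

record Atom (F D : Set) : Set where
  field
    α   : F → ℤ
    β   : F → ℤ
    γ   : D → ℤ
    rel : Rel▷
open Atom public

Node : Set → Set → Set
Node F D = F ⊎ D

OccursIn : {F D : Set} → Node F D → Atom F D → Set
OccursIn (inj₁ f) a = (α a f ≢ 0ℤ) ⊎ (β a f ≢ 0ℤ)
OccursIn (inj₂ d) a = γ a d ≢ 0ℤ

-- Template in CNF: list of conjuncts, each a list (disjunction) of atoms.
Template : Set → Set → Set
Template F D = List (List (Atom F D))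

Occ : {F D : Set} → Template F D → Set
Occ T = Σ (Fin (length T)) (λ c → Fin (length (lookup T c)))

atomAt : {F D : Set} (T : Template F D) → Occ T → Atom F D
atomAt T (c , i) = lookup (lookup T c) i

DepEdge : {F D : Set} (T : Template F D) → Node F D → Node F D → Set
DepEdge T u v = Σ (Occ T) (λ o → OccursIn u (atomAt T o) × OccursIn v (atomAt T o))

Path : {F D : Set} (T : Template F D) → Node F D → Node F D → Set
Path T = Star (DepEdge T)

data Color : Set where
  white red blue : Color

Coloring : {F D : Set} → Template F D → Set
Coloring T = Occ T → Color

RedBlue : {F D : Set} (T : Template F D) → Coloring T → Node F D → Node F D → Set
RedBlue T η u v =
  Σ (Fin (length T)) λ c → Σ (Fin (length (lookup T c))) λ i → Σ (Fin (length (lookup T c))) λ j →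
    (η (c , i) ≡ red) × (η (c , j) ≡ blue) ×
    OccursIn u (atomAt T (c , i)) × OccursIn v (atomAt T (c , j))

-- edge ([u],[v]) of the coloring graph G_η, lifted to representatives
ColEdge : {F D : Set} (T : Template F D) → Coloring T → Node F D → Node F D → Set
ColEdge T η u v = Σ (Node _ _) λ u' → Σ (Node _ _) λ v' →
  Path T u u' × Path T v v' × RedBlue T η u' v'

CondA : {F D : Set} (T : Template F D) → Coloring T → Set
CondA T η = (c : Fin (length T)) → Σ (Fin (length (lookup T c))) λ i →
  (η (c , i) ≡ red) × ((j : Fin (length (lookup T c))) → η (c , j) ≡ red → j ≡ i)

CondB : {F D : Set} (T : Template F D) → Coloring T → Set
CondB T η = (o₁ o₂ : Occ T) → o₁ ≢ o₂ → η o₁ ≡ blue → η o₂ ≡ blue →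
  (u v : Node _ _) → OccursIn u (atomAt T o₁) → OccursIn v (atomAt T o₂) → ¬ Path T u v

CondC : {F D : Set} (T : Template F D) → Coloring T → Set
CondC T η = (u : Node _ _) → ¬ TransClosure (ColEdge T η) u u

Suitable : {F D : Set} (T : Template F D) → Coloring T → Set
Suitable T η = CondA T η × CondB T η × CondC T η

countFin : (n : ℕ) → (Fin n → Bool) → ℕ
countFin zero    p = 0
countFin (suc n) p = (if p zero then 1 else 0) + countFin n (λ i → p (suc i))

sumFin : (n : ℕ) → (Fin n → ℕ) → ℕ
sumFin zero    f = 0
sumFin (suc n) f = f zero + sumFin n (λ i → f (suc i))

isWhite : Color → Bool
isWhite white = true
isWhite red   = false
isWhite blue  = false

deg : {F D : Set} (T : Template F D) → Coloring T → ℕ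
deg T η = sumFin (length T) λ c → countFin (length (lookup T c)) λ i → isWhite (η (c , i))

HasDegree : {F D : Set} → Template F D → ℕ → Set
HasDegree T d = (Σ (Coloring T) λ η → Suitable T η × deg T η ≡ d)
              × ((η : Coloring T) → Suitable T η → d ≤ deg T η)

-- The k-piece ranking function template.
-- F = Fin k ⊎ Fin k : inj₁ i = f_i, inj₂ i = g_i ;  D = ⊤ : tt = δ

RF : ℕ → Set
RF k = Fin k ⊎ Fin k

_≟RF_ : {k : ℕ} → DecidableEquality (RF k)
_≟RF_ = ≡-dec _≟F_ _≟F_

pt : {k : ℕ} → RF k → ℤ → RF k → ℤ
pt s c t = if does (s ≟RF t) then c else 0ℤ

zeroF : {k : ℕ} → RF k → ℤ
zeroF _ = 0ℤ

zeroD : ⊤ → ℤ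
zeroD _ = 0ℤ

δpos : {k : ℕ} → Atom (RF k) ⊤
δpos = record { α = zeroF ; β = zeroF ; γ = λ _ → 1ℤ ; rel = gt }

-- g_i(x) < 0   i.e.  -g_i(x) > 0
gneg : {k : ℕ} → Fin k → Atom (RF k) ⊤
gneg i = record { α = pt (inj₂ i) -1ℤ ; β = zeroF ; γ = zeroD ; rel = gt }

-- g_j(x') < 0   i.e.  -g_j(x') > 0
gneg' : {k : ℕ} → Fin k → Atom (RF k) ⊤
gneg' j = record { α = zeroF ; β = pt (inj₂ j) -1ℤ ; γ = zeroD ; rel = gt }

-- f_j(x') < f_i(x) - δ   i.e.  f_i(x) - f_j(x') - δ > 0
fdec : {k : ℕ} → Fin k → Fin k → Atom (RF k) ⊤
fdec i j = record { α = pt (inj₁ i) 1ℤ ; β = pt (inj₁ j) -1ℤ ; γ = λ _ → -1ℤ ; rel = gt }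

fpos : {k : ℕ} → Fin k → Atom (RF k) ⊤
fpos i = record { α = pt (inj₁ i) 1ℤ ; β = zeroF ; γ = zeroD ; rel = gt }

gnonneg : {k : ℕ} → Fin k → Atom (RF k) ⊤
gnonneg i = record { α = pt (inj₂ i) 1ℤ ; β = zeroF ; γ = zeroD ; rel = ge }

rankingTemplate : (k : ℕ) → Template (RF k) ⊤
rankingTemplate k =
  (δpos ∷ [])
  ∷ (concatMap (λ i → map (λ j → gneg i ∷ gneg' j ∷ fdec i j ∷ []) (allFin k)) (allFin k)
  ++ map (λ i → fpos i ∷ []) (allFin k)
  ++ (map gnonneg (allFin k) ∷ []))

module Submission where

-- If the dependency graph of a template T has at most n+1
-- components, any suitable colouring has at most n blue occurrences: by condition (b)
-- different blue occurrences lie in different components, and if every component held a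
-- blue occurrence, the red occurrence of its conjunct (condition (a)) would give every
-- component a predecessor in G_η, so G_η would have a cycle, against (c).  Since (a) also
-- makes exactly one occurrence per conjunct red, at least  #occurrences - n - #conjuncts
-- occurrences are white.  The ranking template has k+1 components ({δ} ∪ {f_i} and each
-- g_i), 3k²+2k+1 occurrences and k²+k+2 conjuncts, giving at least 2k² - 1 white ones.
--
-- Upper bound (indices run over Fin k, from 0).  Colour δ > 0, each f_i(x) > 0 and the
-- decrease atom f_j(x′) < f_i(x) - δ of each step conjunct red, except in the step
-- conjunct i = j = 0, where g₀(x) < 0 is red and the decrease atom blue; in ⋁ g_i(x) ≥ 0
-- colour g₀ red and the others blue.  The k blue occurrences sit in distinct components,
-- all edges of G_η leave the component of g₀, and exactly 2k² - 1 guard atoms stay white.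

open import Defs
open import Data.Nat using (ℕ; zero; suc; _+_; _*_; _∸_; _≤_; z≤n; s≤s)
open import Data.Nat.Properties
  using (+-0-commutativeMonoid; +-mono-≤; +-identityʳ; *-identityʳ; *-zeroʳ; ≤-reflexive; ≤-antisym; ≤-trans;
         m≤m+n; m≤n+m; +-comm; +-assoc; +-suc; +-monoˡ-≤; +-monoʳ-≤; n<1+n; m+[n∸m]≡n; m+n∸n≡m;
         +-cancelʳ-≤; ∸-monoˡ-≤)
open import Data.Nat.Tactic.RingSolver using (solve-∀)
open import Algebra.Properties.CommutativeMonoid.Sum +-0-commutativeMonoid using (sum; ∑-comm; ∑-distrib-+)
open import Data.Integer using (0ℤ)
open import Data.Fin as Fin using (Fin; zero; suc; toℕ)
open import Data.Fin.Properties using (suc-injective; toℕ-injective; pigeonhole; any?; ¬∀⟶∃¬) renaming (_≟_ to _≟F_)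
open import Data.Bool using (Bool; true; false; _∧_; if_then_else_)
open import Data.Unit using (⊤; tt)
open import Data.Empty using (⊥-elim)
open import Data.Product using (Σ; _×_; _,_; proj₁; proj₂)
open import Data.Product.Properties using (≡-dec)
open import Data.Sum using (inj₁; inj₂)
open import Data.List using (List; []; _∷_; _++_; length; lookup; map; concatMap; tabulate; allFin; foldr; drop)
open import Data.List.Properties using (length-map; length-tabulate)
open import Data.List.Relation.Unary.All as All using (All; []; _∷_)
open import Data.List.Relation.Unary.All.Properties using (++⁺; map⁺; concat⁺; tabulate⁺)
open import Data.List.Relation.Unary.Any using (index; here; there)
open import Data.List.Relation.Unary.Any.Properties using (lookup-index; ++⁺ˡ) renaming (tabulate⁺ to any-tabulate⁺)
open import Data.List.Membership.Propositional using (_∈_)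
open import Data.List.Membership.Propositional.Properties using (∈-lookup; ∈-map⁺; ∈-concatMap⁺; ∈-allFin)
open import Function using (_∋_)
open import Relation.Nullary using (¬_; Dec; does; yes; no)
open import Relation.Nullary.Decidable using (dec-true; decidable-stable; map′; _×-dec_)
open import Relation.Binary.PropositionalEquality
open import Relation.Binary.Construct.Closure.ReflexiveTransitive using (ε; _◅_)
open import Relation.Binary.Construct.Closure.Transitive using (TransClosure; [_]; _∷_)

sumFin≡sum : ∀ n (f : Fin n → ℕ) → sumFin n f ≡ sum f
sumFin≡sum zero    f = refl
sumFin≡sum (suc n) f = cong (f zero +_) (sumFin≡sum n (λ i → f (suc i)))

sumFin-cong : ∀ n {f g : Fin n → ℕ} → (∀ i → f i ≡ g i) → sumFin n f ≡ sumFin n g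
sumFin-cong zero    e = refl
sumFin-cong (suc n) e = cong₂ _+_ (e zero) (sumFin-cong n (λ i → e (suc i)))

sumFin-const : ∀ n c → sumFin n (λ _ → c) ≡ n * c
sumFin-const zero    c = refl
sumFin-const (suc n) c = cong (c +_) (sumFin-const n c)

sumFin-zero : ∀ n {f : Fin n → ℕ} → (∀ i → f i ≡ 0) → sumFin n f ≡ 0
sumFin-zero n e = trans (sumFin-cong n e) (trans (sumFin-const n 0) (*-zeroʳ n))

sumFin-+ : ∀ n (f g : Fin n → ℕ) → sumFin n (λ i → f i + g i) ≡ sumFin n f + sumFin n g
sumFin-+ n f g = begin
  sumFin n (λ i → f i + g i) ≡⟨ sumFin≡sum n _ ⟩
  sum (λ i → f i + g i)      ≡⟨ ∑-distrib-+ f g ⟩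
  sum f + sum g              ≡⟨ sym (cong₂ _+_ (sumFin≡sum n f) (sumFin≡sum n g)) ⟩
  sumFin n f + sumFin n g    ∎
  where open ≡-Reasoning

sumFin-swap : ∀ m n (f : Fin m → Fin n → ℕ) →
  sumFin m (λ i → sumFin n (f i)) ≡ sumFin n (λ j → sumFin m (λ i → f i j))
sumFin-swap m n f = begin
  sumFin m (λ i → sumFin n (f i))          ≡⟨ sumFin-cong m (λ i → sumFin≡sum n (f i)) ⟩
  sumFin m (λ i → sum (f i))               ≡⟨ sumFin≡sum m _ ⟩
  sum (λ i → sum (f i))                    ≡⟨ ∑-comm f ⟩
  sum (λ j → sum (λ i → f i j))            ≡⟨ sym (sumFin≡sum n _) ⟩
  sumFin n (λ j → sum (λ i → f i j))       ≡⟨ sumFin-cong n (λ j → sym (sumFin≡sum m _)) ⟩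
  sumFin n (λ j → sumFin m (λ i → f i j))  ∎
  where open ≡-Reasoning

sum≤length : ∀ n (f : Fin n → ℕ) → (∀ i → f i ≤ 1) → sumFin n f ≤ n
sum≤length zero    f le = z≤n
sum≤length (suc n) f le = +-mono-≤ (le zero) (sum≤length n (λ i → f (suc i)) (λ i → le (suc i)))

sum≤length-with-zero : ∀ n (f : Fin (suc n) → ℕ) → (∀ i → f i ≤ 1) →
  (i₀ : Fin (suc n)) → f i₀ ≡ 0 → sumFin (suc n) f ≤ n
sum≤length-with-zero n       f le zero     e rewrite e = sum≤length n (λ i → f (suc i)) (λ i → le (suc i))
sum≤length-with-zero (suc n) f le (suc i₀) e =
  +-mono-≤ (le zero) (sum≤length-with-zero n (λ i → f (suc i)) (λ i → le (suc i)) i₀ e)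

term≤sum : ∀ n (f : Fin n → ℕ) (i : Fin n) → f i ≤ sumFin n f
term≤sum (suc n) f zero    = m≤m+n (f zero) _
term≤sum (suc n) f (suc i) = ≤-trans (term≤sum n (λ j → f (suc j)) i) (m≤n+m _ (f zero))

sum≤1 : ∀ n (f : Fin n → ℕ) → (∀ i → f i ≤ 1) → (∀ i j → 1 ≤ f i → 1 ≤ f j → i ≡ j) → sumFin n f ≤ 1
sum≤1 zero    f le uniq = z≤n
sum≤1 (suc n) f le uniq with f zero in f₀
... | zero  = sum≤1 n (λ i → f (suc i)) (λ i → le (suc i)) (λ i j p q → suc-injective (uniq (suc i) (suc j) p q))
... | suc m = subst (λ r → suc m + r ≤ 1) (sym (sumFin-zero n restVanishes))
                (subst (_≤ 1) (trans f₀ (sym (+-identityʳ (suc m)))) (le zero))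
  where
  restVanishes : ∀ i → f (suc i) ≡ 0
  restVanishes i with f (suc i) in fᵢ
  ... | zero  = refl
  ... | suc _ with uniq zero (suc i) (subst (1 ≤_) (sym f₀) (s≤s z≤n)) (subst (1 ≤_) (sym fᵢ) (s≤s z≤n))
  ...   | ()

indicator : Bool → ℕ
indicator b = if b then 1 else 0

indicator≤1 : ∀ b → indicator b ≤ 1
indicator≤1 true  = s≤s z≤n
indicator≤1 false = z≤n

indicator-pos : ∀ b → 1 ≤ indicator b → b ≡ true
indicator-pos true _ = refl

indicator-neg : ∀ b → ¬ b ≡ true → indicator b ≡ 0
indicator-neg true  nt = ⊥-elim (nt refl)
indicator-neg false _  = refl

does-true : ∀ {A : Set} (a? : Dec A) → does a? ≡ true → A
does-true (yes a) _ = a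

countFin≡sum : ∀ n (p : Fin n → Bool) → countFin n p ≡ sumFin n (λ i → indicator (p i))
countFin≡sum zero    p = refl
countFin≡sum (suc n) p = cong (indicator (p zero) +_) (countFin≡sum n (λ i → p (suc i)))

count≤1 : ∀ n (p : Fin n → Bool) → (∀ i j → p i ≡ true → p j ≡ true → i ≡ j) → countFin n p ≤ 1
count≤1 n p uniq = subst (_≤ 1) (sym (countFin≡sum n p))
  (sum≤1 n _ (λ i → indicator≤1 (p i)) (λ i j a b → uniq i j (indicator-pos _ a) (indicator-pos _ b)))

count≥1 : ∀ n (p : Fin n → Bool) (i : Fin n) → p i ≡ true → 1 ≤ countFin n p
count≥1 n p i pᵢ = subst (1 ≤_) (sym (countFin≡sum n p))
  (≤-trans (≤-reflexive (sym (cong indicator pᵢ))) (term≤sum n _ i))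

count-witness : ∀ n (p : Fin n → Bool) → 1 ≤ countFin n p → Σ (Fin n) λ i → p i ≡ true
count-witness (suc n) p pos with p zero in p₀
... | true  = zero , p₀
... | false with count-witness n (λ i → p (suc i)) pos
...   | i , pᵢ = suc i , pᵢ

count-none : ∀ n (p : Fin n → Bool) → (∀ i → ¬ p i ≡ true) → countFin n p ≡ 0
count-none n p none = trans (countFin≡sum n p) (sumFin-zero n (λ i → indicator-neg (p i) (none i)))

indicator-split : ∀ N (b : Bool) (y : Fin N) → indicator b ≡ sumFin N (λ x → indicator (b ∧ does (y ≟F x)))
indicator-split N false y = sym (sumFin-zero N (λ _ → refl))
indicator-split N true  y = ≤-antisym
  (≤-trans (≤-reflexive (cong indicator (sym (dec-true (y ≟F y) refl)))) (term≤sum N _ y))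
  (sum≤1 N _ (λ x → indicator≤1 _)
    (λ x x′ a b → trans (sym (does-true (y ≟F x) (indicator-pos _ a))) (does-true (y ≟F x′) (indicator-pos _ b))))

module _ {F D : Set} (T : Template F D) where

  countOcc : (Occ T → Bool) → ℕ
  countOcc p = sumFin (length T) λ c → countFin (length (lookup T c)) λ i → p (c , i)

  occurrences : ℕ
  occurrences = sumFin (length T) λ c → length (lookup T c)

  position-injective : ∀ {c : Fin (length T)} {i j} → (Occ T ∋ (c , i)) ≡ (c , j) → i ≡ j
  position-injective refl = refl

  countOcc≤1 : (p : Occ T → Bool) → (∀ o o′ → p o ≡ true → p o′ ≡ true → o ≡ o′) → countOcc p ≤ 1
  countOcc≤1 p uniq = sum≤1 (length T) _
    (λ c → count≤1 _ _ (λ i j a b → position-injective (uniq (c , i) (c , j) a b)))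
    (λ c c′ a b → cong proj₁ (uniq (c , proj₁ (witness c a)) (c′ , proj₁ (witness c′ b))
                                   (proj₂ (witness c a)) (proj₂ (witness c′ b))))
    where
    witness : ∀ c → 1 ≤ countFin (length (lookup T c)) (λ i → p (c , i)) →
              Σ (Fin (length (lookup T c))) λ i → p (c , i) ≡ true
    witness c = count-witness _ (λ i → p (c , i))

  countOcc-none : (p : Occ T → Bool) → (∀ o → ¬ p o ≡ true) → countOcc p ≡ 0
  countOcc-none p none = sumFin-zero (length T) (λ c → count-none _ _ (λ i → none (c , i)))

  countOcc-by-label : ∀ {N} (p : Occ T → Bool) (lab : Occ T → Fin N) →
    countOcc p ≡ sumFin N (λ x → countOcc (λ o → p o ∧ does (lab o ≟F x)))
  countOcc-by-label {N} p lab = begin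
    countOcc p
      ≡⟨ sumFin-cong L (λ c → countFin≡sum (m c) _) ⟩
    sumFin L (λ c → sumFin (m c) (λ i → indicator (p (c , i))))
      ≡⟨ sumFin-cong L (λ c → sumFin-cong (m c) (λ i → indicator-split N (p (c , i)) (lab (c , i)))) ⟩
    sumFin L (λ c → sumFin (m c) (λ i → sumFin N (λ x → ind x c i)))
      ≡⟨ sumFin-cong L (λ c → sumFin-swap (m c) N (λ i x → ind x c i)) ⟩
    sumFin L (λ c → sumFin N (λ x → sumFin (m c) (ind x c)))
      ≡⟨ sumFin-swap L N (λ c x → sumFin (m c) (ind x c)) ⟩
    sumFin N (λ x → sumFin L (λ c → sumFin (m c) (ind x c)))
      ≡⟨ sumFin-cong N (λ x → sumFin-cong L (λ c → sym (countFin≡sum (m c) _))) ⟩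
    sumFin N (λ x → countOcc (λ o → p o ∧ does (lab o ≟F x))) ∎
    where
    open ≡-Reasoning
    L : ℕ
    L = length T
    m : Fin L → ℕ
    m c = length (lookup T c)
    ind : Fin N → (c : Fin L) → Fin (m c) → ℕ
    ind x c i = indicator (p (c , i) ∧ does (lab (c , i) ≟F x))

blue? : (c : Color) → Dec (c ≡ blue)
blue? white = no λ ()
blue? red   = no λ ()
blue? blue  = yes refl

red? : (c : Color) → Dec (c ≡ red)
red? white = no λ ()
red? red   = yes refl
red? blue  = no λ ()

isBlue isRed : Color → Bool
isBlue c = does (blue? c)
isRed  c = does (red? c)

one-colour : ∀ c → indicator (isWhite c) + indicator (isBlue c) + indicator (isRed c) ≡ 1
one-colour white = refl
one-colour red   = refl
one-colour blue  = refl

colour-partition : ∀ m (g : Fin m → Color) →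
  countFin m (λ i → isWhite (g i)) + countFin m (λ i → isBlue (g i)) + countFin m (λ i → isRed (g i)) ≡ m
colour-partition m g = begin
  countFin m (λ i → isWhite (g i)) + countFin m (λ i → isBlue (g i)) + countFin m (λ i → isRed (g i))
    ≡⟨ cong₂ _+_ (cong₂ _+_ (countFin≡sum m _) (countFin≡sum m _)) (countFin≡sum m _) ⟩
  sumFin m W + sumFin m B + sumFin m R
    ≡⟨ cong (_+ sumFin m R) (sym (sumFin-+ m W B)) ⟩
  sumFin m (λ i → W i + B i) + sumFin m R
    ≡⟨ sym (sumFin-+ m _ R) ⟩
  sumFin m (λ i → W i + B i + R i)
    ≡⟨ sumFin-cong m (λ i → one-colour (g i)) ⟩
  sumFin m (λ _ → 1)
    ≡⟨ trans (sumFin-const m 1) (*-identityʳ m) ⟩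
  m ∎
  where
  open ≡-Reasoning
  W B R : Fin m → ℕ
  W i = indicator (isWhite (g i))
  B i = indicator (isBlue (g i))
  R i = indicator (isRed (g i))

-- If every element of a finite set has a predecessor, following predecessors must
-- revisit some element (pigeonhole), which closes a cycle.
predecessor-cycle : ∀ {A : Set} {R : A → A → Set} {n} (rep : Fin (suc n) → A) (pred : Fin (suc n) → Fin (suc n)) →
  (∀ x → R (rep (pred x)) (rep x)) → Σ (Fin (suc n)) λ x → TransClosure R (rep x) (rep x)
predecessor-cycle {R = R} {n} rep pred edge =
  close-cycle (pigeonhole (n<1+n (suc n)) (λ j → back (toℕ j)))
  where
  back : ℕ → Fin (suc n)
  back zero    = zero
  back (suc t) = pred (back t)
  chain : ∀ d t → TransClosure R (rep (back (suc d + t))) (rep (back t))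
  chain zero    t = [ edge (back t) ]
  chain (suc d) t = edge (back (suc d + t)) ∷ chain d t
  close-cycle : (Σ (Fin (suc (suc n))) λ i → Σ (Fin (suc (suc n))) λ j → i Fin.< j × back (toℕ i) ≡ back (toℕ j)) →
                Σ (Fin (suc n)) λ x → TransClosure R (rep x) (rep x)
  close-cycle (i , j , i<j , same) =
    back (toℕ i) , subst (λ y → TransClosure R (rep y) (rep (back (toℕ i)))) revisit (chain d (toℕ i))
    where
    d : ℕ
    d = toℕ j ∸ suc (toℕ i)
    revisit : back (suc d + toℕ i) ≡ back (toℕ i)
    revisit = trans (cong back (trans (+-comm (suc d) (toℕ i)) (trans (+-suc (toℕ i) d) (m+[n∸m]≡n i<j)))) (sym same)

edges-across⇒acyclic : ∀ {A : Set} {R : A → A → Set} (S : A → Set) →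
  (∀ {x y} → R x y → S x × ¬ S y) → ∀ x → ¬ TransClosure R x x
edges-across⇒acyclic {R = R} S across x cycle = proj₂ (endpoints cycle) (proj₁ (endpoints cycle))
  where
  endpoints : ∀ {x y} → TransClosure R x y → S x × ¬ S y
  endpoints [ e ]    = across e
  endpoints (e ∷ es) = proj₁ (across e) , proj₂ (endpoints es)

-- A lower bound on the degree of any template

-- Let T be a template whose dependency graph has at most n+1 components, witnessed by a
-- labelling of the nodes with n+1 labels such that equally labelled nodes are connected,
-- and in which every atom contains some symbol or variable.  Then a suitable colouring
-- has at most n blue occurrences: by (b) distinct blue occurrences carry distinct labels,
-- and by (a) and (c) not every label carries a blue occurrence.  As (a) also fixes one red
-- occurrence per conjunct, at least  occurrences - n - #conjuncts  occurrences are white.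
module DegreeLowerBound {F D : Set} (T : Template F D) {n : ℕ}
  (label     : Node F D → Fin (suc n))
  (connected : ∀ u v → label u ≡ label v → Path T u v)
  (occupant  : (o : Occ T) → Σ (Node F D) λ u → OccursIn u (atomAt T o))
  (η : Coloring T) (suitable : Suitable T η) where

  condA : CondA T η
  condA = proj₁ suitable
  condB : CondB T η
  condB = proj₁ (proj₂ suitable)
  condC : CondC T η
  condC = proj₂ (proj₂ suitable)

  occLabel : Occ T → Fin (suc n)
  occLabel o = label (proj₁ (occupant o))

  blue-labels-distinct : ∀ o o′ → η o ≡ blue → η o′ ≡ blue → occLabel o ≡ occLabel o′ → o ≡ o′
  blue-labels-distinct o o′ b b′ same = decidable-stable (≡-dec _≟F_ _≟F_ o o′) λ o≢o′ →
    condB o o′ o≢o′ b b′ _ _ (proj₂ (occupant o)) (proj₂ (occupant o′)) (connected _ _ same)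

  BlueAt : Fin (suc n) → Set
  BlueAt x = Σ (Occ T) λ o → η o ≡ blue × occLabel o ≡ x

  blueAt? : (x : Fin (suc n)) → Dec (BlueAt x)
  blueAt? x = map′ (λ (c , i , b , e) → (c , i) , b , e) (λ ((c , i) , b , e) → c , i , b , e)
    (any? λ c → any? λ i → blue? (η (c , i)) ×-dec (occLabel (c , i) ≟F x))

  -- Conditions (a) and (c): if every label carried a blue occurrence, the red occurrence of
  -- its conjunct would give every component a predecessor in G_η, hence a cycle.
  some-label-not-blue : Σ (Fin (suc n)) λ x → ¬ BlueAt x
  some-label-not-blue = ¬∀⟶∃¬ (suc n) BlueAt blueAt? every-label-blue⇒cycle
    where
    every-label-blue⇒cycle : ¬ (∀ x → BlueAt x)
    every-label-blue⇒cycle W = condC _ (proj₂ (predecessor-cycle rep pred edge))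
      where
      blueOcc redOcc : Fin (suc n) → Occ T
      blueOcc x = proj₁ (W x)
      redOcc x = proj₁ (blueOcc x) , proj₁ (condA (proj₁ (blueOcc x)))
      rep : Fin (suc n) → Node F D
      rep x = proj₁ (occupant (blueOcc x))
      pred : Fin (suc n) → Fin (suc n)
      pred x = occLabel (redOcc x)
      edge : ∀ x → ColEdge T η (rep (pred x)) (rep x)
      edge x = proj₁ (occupant (redOcc x)) , rep x
             , connected _ _ (proj₂ (proj₂ (W (pred x)))) , ε
             , proj₁ (blueOcc x) , proj₂ (redOcc x) , proj₂ (blueOcc x)
             , proj₁ (proj₂ (condA (proj₁ (blueOcc x)))) , proj₁ (proj₂ (W x))
             , proj₂ (occupant (redOcc x)) , proj₂ (occupant (blueOcc x))

  -- Hence at most n occurrences are blue: counted label by label, each label carries at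
  -- most one blue occurrence and the label x₀ none.
  blueCount : ℕ
  blueCount = countOcc T (λ o → isBlue (η o))

  blueCount≤n : blueCount ≤ n
  blueCount≤n = subst (_≤ n) (sym (countOcc-by-label T _ occLabel))
    (sum≤length-with-zero n _ at-most-one x₀ (countOcc-none T _ (λ o e → not-blue (o , unpack o e))))
    where
    x₀ : Fin (suc n)
    x₀ = proj₁ some-label-not-blue
    not-blue : ¬ BlueAt x₀
    not-blue = proj₂ some-label-not-blue
    blueWith : Fin (suc n) → Occ T → Bool
    blueWith x o = isBlue (η o) ∧ does (occLabel o ≟F x)
    unpack : ∀ {x} o → blueWith x o ≡ true → η o ≡ blue × occLabel o ≡ x
    unpack o e with isBlue (η o) in b
    ... | true = does-true (blue? _) b , does-true (_ ≟F _) e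
    at-most-one : ∀ x → countOcc T (blueWith x) ≤ 1
    at-most-one x = countOcc≤1 T _ λ o o′ e e′ →
      blue-labels-distinct o o′ (proj₁ (unpack o e)) (proj₁ (unpack o′ e′))
        (trans (proj₂ (unpack o e)) (sym (proj₂ (unpack o′ e′))))

  one-red : ∀ c → countFin (length (lookup T c)) (λ i → isRed (η (c , i))) ≡ 1
  one-red c = ≤-antisym
    (count≤1 _ _ (λ i j e e′ → trans (only i (does-true (red? _) e)) (sym (only j (does-true (red? _) e′)))))
    (count≥1 _ _ r (dec-true (red? _) isred))
    where
    r : Fin (length (lookup T c))
    r = proj₁ (condA c)
    isred : η (c , r) ≡ red
    isred = proj₁ (proj₂ (condA c))
    only : ∀ j → η (c , j) ≡ red → j ≡ r
    only = proj₂ (proj₂ (condA c))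

  -- Every occurrence is white, blue, or one of the red ones.
  colour-count : deg T η + blueCount + length T ≡ occurrences T
  colour-count = begin
    deg T η + blueCount + length T
      ≡⟨ cong₂ _+_ (sym (sumFin-+ L W B)) (sym (trans (sumFin-const L 1) (*-identityʳ L))) ⟩
    sumFin L (λ c → W c + B c) + sumFin L (λ _ → 1)
      ≡⟨ sym (sumFin-+ L _ _) ⟩
    sumFin L (λ c → W c + B c + 1)
      ≡⟨ sumFin-cong L (λ c → trans (cong (W c + B c +_) (sym (one-red c))) (colour-partition _ (λ i → η (c , i)))) ⟩
    occurrences T ∎
    where
    open ≡-Reasoning
    L : ℕ
    L = length T
    W B : Fin L → ℕ
    W c = countFin (length (lookup T c)) (λ i → isWhite (η (c , i)))
    B c = countFin (length (lookup T c)) (λ i → isBlue (η (c , i)))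

  degree-lower-bound : occurrences T ≤ deg T η + n + length T
  degree-lower-bound = subst (_≤ deg T η + n + length T) colour-count
    (+-monoˡ-≤ (length T) (+-monoʳ-≤ (deg T η) blueCount≤n))

deltaConjunct : ∀ {k} → List (Atom (RF k) ⊤)
deltaConjunct = δpos ∷ []

stepConjunct : ∀ {k} → Fin k → Fin k → List (Atom (RF k) ⊤)
stepConjunct i j = gneg i ∷ gneg' j ∷ fdec i j ∷ []

positivityConjunct : ∀ {k} → Fin k → List (Atom (RF k) ⊤)
positivityConjunct i = fpos i ∷ []

coverConjunct : ∀ k → List (Atom (RF k) ⊤)
coverConjunct k = map gnonneg (allFin k)

stepConjuncts : ∀ k → List (List (Atom (RF k) ⊤))
stepConjuncts k = concatMap (λ i → map (stepConjunct i) (allFin k)) (allFin k)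

total : ∀ {A : Set} → (A → ℕ) → List A → ℕ
total h = foldr (λ x r → h x + r) 0

total-++ : ∀ {A : Set} (h : A → ℕ) (xs ys : List A) → total h (xs ++ ys) ≡ total h xs + total h ys
total-++ h []       ys = refl
total-++ h (x ∷ xs) ys = trans (cong (h x +_) (total-++ h xs ys)) (sym (+-assoc (h x) _ _))

total-map-tabulate : ∀ {A B : Set} (h : A → ℕ) n (f : Fin n → B) (g : B → A) →
  total h (map g (tabulate f)) ≡ sumFin n (λ i → h (g (f i)))
total-map-tabulate h zero    f g = refl
total-map-tabulate h (suc n) f g = cong (h (g (f zero)) +_) (total-map-tabulate h n (λ i → f (suc i)) g)

total-concatMap-tabulate : ∀ {A B : Set} (h : A → ℕ) n (f : Fin n → B) (g : B → List A) →
  total h (concatMap g (tabulate f)) ≡ sumFin n (λ i → total h (g (f i)))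
total-concatMap-tabulate h zero    f g = refl
total-concatMap-tabulate h (suc n) f g =
  trans (total-++ h (g (f zero)) _) (cong (total h (g (f zero)) +_) (total-concatMap-tabulate h n (λ i → f (suc i)) g))

sumFin-lookup : ∀ {A : Set} (h : A → ℕ) (xs : List A) → sumFin (length xs) (λ c → h (lookup xs c)) ≡ total h xs
sumFin-lookup h []       = refl
sumFin-lookup h (x ∷ xs) = cong (h x +_) (sumFin-lookup h xs)

template-total : ∀ k (h : List (Atom (RF k) ⊤) → ℕ) → total h (rankingTemplate k) ≡
  h deltaConjunct + (sumFin k (λ i → sumFin k (λ j → h (stepConjunct i j)))
                    + (sumFin k (λ i → h (positivityConjunct i)) + (h (coverConjunct k) + 0)))
template-total k h = begin
  total h (rankingTemplate k)
    ≡⟨ cong (h deltaConjunct +_) (total-++ h (stepConjuncts k) _) ⟩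
  h deltaConjunct + (total h (stepConjuncts k) + total h (map positivityConjunct (allFin k) ++ _))
    ≡⟨ cong (λ r → h deltaConjunct + (total h (stepConjuncts k) + r)) (total-++ h (map positivityConjunct (allFin k)) _) ⟩
  h deltaConjunct + (total h (stepConjuncts k) + (total h (map positivityConjunct (allFin k)) + (h (coverConjunct k) + 0)))
    ≡⟨ cong₂ (λ a b → h deltaConjunct + (a + (b + (h (coverConjunct k) + 0)))) steps
             (total-map-tabulate h k (λ i → i) positivityConjunct) ⟩
  h deltaConjunct + (sumFin k (λ i → sumFin k (λ j → h (stepConjunct i j)))
                    + (sumFin k (λ i → h (positivityConjunct i)) + (h (coverConjunct k) + 0))) ∎
  where
  open ≡-Reasoning
  steps : total h (stepConjuncts k) ≡ sumFin k (λ i → sumFin k (λ j → h (stepConjunct i j)))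
  steps = trans (total-concatMap-tabulate h k (λ i → i) _)
                (sumFin-cong k (λ i → total-map-tabulate h k (λ j → j) (stepConjunct i)))

template-conjuncts : ∀ k → length (rankingTemplate k) ≡ k * k + k + 2
template-conjuncts k = begin
  length T                            ≡⟨ sym (*-identityʳ (length T)) ⟩
  length T * 1                        ≡⟨ sym (sumFin-const (length T) 1) ⟩
  sumFin (length T) (λ _ → 1)         ≡⟨ sumFin-lookup (λ _ → 1) T ⟩
  total (λ _ → 1) T                   ≡⟨ template-total k (λ _ → 1) ⟩
  1 + (sumFin k (λ _ → sumFin k (λ _ → 1)) + (sumFin k (λ _ → 1) + (1 + 0)))
    ≡⟨ cong₂ (λ a b → 1 + (a + (b + (1 + 0))))
             (trans (sumFin-cong k (λ _ → sumFin-const k 1)) (sumFin-const k (k * 1))) (sumFin-const k 1) ⟩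
  1 + (k * (k * 1) + (k * 1 + (1 + 0))) ≡⟨ arithmetic k ⟩
  k * k + k + 2 ∎
  where
  open ≡-Reasoning
  T : Template (RF k) ⊤
  T = rankingTemplate k
  arithmetic : ∀ k → 1 + (k * (k * 1) + (k * 1 + (1 + 0))) ≡ k * k + k + 2
  arithmetic = solve-∀

template-occurrences : ∀ k → occurrences (rankingTemplate k) ≡ 3 * k * k + 2 * k + 1
template-occurrences k = begin
  occurrences T        ≡⟨ sumFin-lookup length T ⟩
  total length T       ≡⟨ template-total k length ⟩
  1 + (sumFin k (λ _ → sumFin k (λ _ → 3)) + (sumFin k (λ _ → 1) + (length (coverConjunct k) + 0)))
    ≡⟨ cong₂ (λ a b → 1 + (a + b))
             (trans (sumFin-cong k (λ _ → sumFin-const k 3)) (sumFin-const k (k * 3)))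
             (cong₂ (λ a b → a + (b + 0)) (sumFin-const k 1) (trans (length-map gnonneg (allFin k)) (length-tabulate (λ i → i)))) ⟩
  1 + (k * (k * 3) + (k * 1 + (k + 0))) ≡⟨ arithmetic k ⟩
  3 * k * k + 2 * k + 1 ∎
  where
  open ≡-Reasoning
  T : Template (RF k) ⊤
  T = rankingTemplate k
  arithmetic : ∀ k → 1 + (k * (k * 3) + (k * 1 + (k + 0))) ≡ 3 * k * k + 2 * k + 1
  arithmetic = solve-∀

-- The components of the dependency graph

component : ∀ {k} → Node (RF k) ⊤ → Fin (suc k)
component (inj₁ (inj₁ i)) = zero
component (inj₁ (inj₂ i)) = suc i
component (inj₂ tt)       = zero

pt-support : ∀ {k} {s t : RF k} {c} → pt s c t ≢ 0ℤ → s ≡ t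
pt-support {s = s} {t} h with s ≟RF t
... | yes s≡t = s≡t
... | no  _   = ⊥-elim (h refl)

pt-at : ∀ {k} (s : RF k) {c} → c ≢ 0ℤ → pt s c s ≢ 0ℤ
pt-at s c≢0 with s ≟RF s
... | yes _  = c≢0
... | no s≢s = ⊥-elim (s≢s refl)

record Located {k} (a : Atom (RF k) ⊤) : Set where
  field
    place    : Fin (suc k)
    inside   : ∀ u → OccursIn u a → component u ≡ place
    occupant : Σ (Node (RF k) ⊤) λ u → OccursIn u a
open Located

inside-by : ∀ {k} (a : Atom (RF k) ⊤) {x : Fin (suc k)} →
  (∀ s → α a s ≢ 0ℤ → component (inj₁ s) ≡ x) → (∀ s → β a s ≢ 0ℤ → component (inj₁ s) ≡ x) →
  (γ a tt ≢ 0ℤ → zero ≡ x) → ∀ u → OccursIn u a → component u ≡ x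
inside-by a onα onβ onγ (inj₁ s)  (inj₁ h) = onα s h
inside-by a onα onβ onγ (inj₁ s)  (inj₂ h) = onβ s h
inside-by a onα onβ onγ (inj₂ tt) h        = onγ h

at-pt : ∀ {k} {s t : RF k} {c} → pt s c t ≢ 0ℤ → component (inj₁ t) ≡ component (inj₁ s)
at-pt h = cong (λ s → component (inj₁ s)) (sym (pt-support h))

absent : ∀ {A : Set} → 0ℤ ≢ 0ℤ → A
absent h = ⊥-elim (h refl)

located-δpos : ∀ {k} → Located (δpos {k})
located-δpos = record
  { place = zero ; inside = inside-by _ (λ _ → absent) (λ _ → absent) (λ _ → refl) ; occupant = inj₂ tt , λ () }

located-gneg : ∀ {k} (i : Fin k) → Located (gneg i)
located-gneg i = record
  { place = suc i ; inside = inside-by _ (λ _ → at-pt) (λ _ → absent) absent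
  ; occupant = inj₁ (inj₂ i) , inj₁ (pt-at (inj₂ i) λ ()) }

located-gneg' : ∀ {k} (i : Fin k) → Located (gneg' i)
located-gneg' i = record
  { place = suc i ; inside = inside-by _ (λ _ → absent) (λ _ → at-pt) absent
  ; occupant = inj₁ (inj₂ i) , inj₂ (pt-at (inj₂ i) λ ()) }

located-fdec : ∀ {k} (i j : Fin k) → Located (fdec i j)
located-fdec i j = record
  { place = zero ; inside = inside-by _ (λ _ → at-pt {s = inj₁ i}) (λ _ → at-pt {s = inj₁ j}) (λ _ → refl)
  ; occupant = inj₂ tt , λ () }

located-fpos : ∀ {k} (i : Fin k) → Located (fpos i)
located-fpos i = record
  { place = zero ; inside = inside-by _ (λ _ → at-pt {s = inj₁ i}) (λ _ → absent) absent
  ; occupant = inj₁ (inj₁ i) , inj₁ (pt-at (inj₁ i) λ ()) }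

located-gnonneg : ∀ {k} (i : Fin k) → Located (gnonneg i)
located-gnonneg i = record
  { place = suc i ; inside = inside-by _ (λ _ → at-pt) (λ _ → absent) absent
  ; occupant = inj₁ (inj₂ i) , inj₁ (pt-at (inj₂ i) λ ()) }

every-atom-located : ∀ k → All (All Located) (rankingTemplate k)
every-atom-located k = (located-δpos ∷ [])
  ∷ ++⁺ (concat⁺ (map⁺ (tabulate⁺ λ i → map⁺ (tabulate⁺ λ j → located-gneg i ∷ located-gneg' j ∷ located-fdec i j ∷ []))))
        (++⁺ (map⁺ (tabulate⁺ λ i → located-fpos i ∷ [])) (map⁺ (tabulate⁺ located-gnonneg) ∷ []))

located : ∀ k (o : Occ (rankingTemplate k)) → Located (atomAt (rankingTemplate k) o)
located k (c , i) = All.lookup (All.lookup (every-atom-located k) (∈-lookup c)) (∈-lookup i)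

path-preserves-component : ∀ k {u v} → Path (rankingTemplate k) u v → component u ≡ component v
path-preserves-component k ε                 = refl
path-preserves-component k ((o , ou , ov) ◅ p) =
  trans (trans (inside (located k o) _ ou) (sym (inside (located k o) _ ov))) (path-preserves-component k p)

occurrence-of : ∀ {F D : Set} {T : Template F D} {C a} → C ∈ T → a ∈ C → Σ (Occ T) λ o → atomAt T o ≡ a
occurrence-of {T = T} C∈T a∈C with index C∈T | lookup-index C∈T
... | c | refl = (c , index a∈C) , sym (lookup-index a∈C)

step-in-template : ∀ k (i j : Fin k) → stepConjunct i j ∈ rankingTemplate k
step-in-template k i j =
  there (++⁺ˡ (∈-concatMap⁺ (λ i → map (stepConjunct i) (allFin k)) (any-tabulate⁺ i (∈-map⁺ (stepConjunct i) (∈-allFin j)))))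

-- Conversely, each component is connected: f_i and δ meet in the atom f_i(x) - f_i(x') - δ > 0.
f-meets-δ : ∀ k (i : Fin k) → DepEdge (rankingTemplate k) (inj₁ (inj₁ i)) (inj₂ tt)
f-meets-δ k i with occurrence-of {T = rankingTemplate k} (step-in-template k i i) (there (there (here refl)))
... | o , o-is-fdec = o , subst (OccursIn (inj₁ (inj₁ i))) (sym o-is-fdec) (inj₁ (pt-at (inj₁ i) λ ()))
                        , subst (OccursIn (inj₂ tt)) (sym o-is-fdec) λ ()

from-δ : ∀ k v → component v ≡ zero → Path (rankingTemplate k) (inj₂ tt) v
from-δ k (inj₁ (inj₁ j)) _ = flip (f-meets-δ k j) ◅ ε
  where
  flip : ∀ {u v} → DepEdge (rankingTemplate k) u v → DepEdge (rankingTemplate k) v u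
  flip (o , ou , ov) = o , ov , ou
from-δ k (inj₁ (inj₂ j)) ()
from-δ k (inj₂ tt)       _ = ε

same-component⇒path : ∀ k u v → component u ≡ component v → Path (rankingTemplate k) u v
same-component⇒path k (inj₁ (inj₂ i)) (inj₁ (inj₂ .i)) refl = ε
same-component⇒path k (inj₁ (inj₁ i)) v e = f-meets-δ k i ◅ from-δ k v (sym e)
same-component⇒path k (inj₂ tt)       v e = from-δ k v (sym e)

-- ≥-atoms occur only in the cover conjunct, whose first atom is red and the others blue;
-- a singleton conjunct is red; in a step conjunct the decrease atom is red, the guards white.
colourBy : Rel▷ → (n : ℕ) → Fin n → Color
colourBy ge _             zero             = red
colourBy ge _             (suc _)          = blue
colourBy gt 1             _                = red
colourBy gt _             (suc (suc zero)) = red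
colourBy gt _             _                = white

standardColour : ∀ {F D : Set} (C : List (Atom F D)) → Fin (length C) → Color
standardColour C p = colourBy (rel (lookup C p)) (length C) p

whites : ∀ {F D : Set} → List (Atom F D) → ℕ
whites C = countFin (length C) λ p → isWhite (standardColour C p)

cover-atom : ∀ {k} n (f : Fin n → Fin k) (p : Fin (length (map gnonneg (tabulate f)))) →
  Σ (Fin n) λ q → lookup (map gnonneg (tabulate f)) p ≡ gnonneg (f q) × toℕ q ≡ toℕ p
cover-atom (suc n) f zero    = zero , refl , refl
cover-atom (suc n) f (suc p) with cover-atom n (λ i → f (suc i)) p
... | q , atom , pos = suc q , atom , cong suc pos

-- The cover conjunct consists of ≥-atoms, so none of its atoms is white.
cover-colour : ∀ k (p : Fin (length (coverConjunct k))) → standardColour (coverConjunct k) p ≡ colourBy ge _ p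
cover-colour k p = cong (λ a → colourBy (rel a) _ p) (proj₁ (proj₂ (cover-atom k (λ i → i) p)))

cover-no-white : ∀ k → whites (coverConjunct k) ≡ 0
cover-no-white k = count-none _ _ λ p white → not-white p (trans (cong isWhite (sym (cover-colour k p))) white)
  where
  not-white : ∀ {n} (p : Fin n) → ¬ isWhite (colourBy ge n p) ≡ true
  not-white zero    ()
  not-white (suc p) ()

HasBlue : ∀ {F D : Set} → List (Atom F D) → Set
HasBlue C = Σ (Fin (length C)) λ p → standardColour C p ≡ blue

AtMostOne : ∀ {A : Set} → (A → Set) → List A → Set
AtMostOne P xs = ∀ c c′ → P (lookup xs c) → P (lookup xs c′) → c ≡ c′

atMostOne-++ : ∀ {A : Set} {P : A → Set} {xs ys : List A} → All (λ x → ¬ P x) xs → AtMostOne P ys → AtMostOne P (xs ++ ys)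
atMostOne-++ []       one c        c′       p p′ = one c c′ p p′
atMostOne-++ (n ∷ ns) one zero     _        p p′ = ⊥-elim (n p)
atMostOne-++ (n ∷ ns) one (suc c)  zero     p p′ = ⊥-elim (n p′)
atMostOne-++ (n ∷ ns) one (suc c)  (suc c′) p p′ = cong suc (atMostOne-++ ns one c c′ p p′)

data Kind {k : ℕ} : List (Atom (RF k) ⊤) → Set where
  delta      : Kind deltaConjunct
  step       : ∀ i j → Kind (stepConjunct i j)
  positivity : ∀ i → Kind (positivityConjunct i)
  cover      : Kind (coverConjunct k)

every-conjunct-kind : ∀ k → All Kind (rankingTemplate k)
every-conjunct-kind k = delta
  ∷ ++⁺ (concat⁺ (map⁺ (tabulate⁺ λ i → map⁺ (tabulate⁺ λ j → step i j))))
        (++⁺ (map⁺ (tabulate⁺ positivity)) (cover ∷ []))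

no-blue-step : ∀ {k} (i j : Fin k) → ¬ HasBlue (stepConjunct i j)
no-blue-step i j (zero , ())
no-blue-step i j (suc zero , ())
no-blue-step i j (suc (suc zero) , ())

no-blue-positivity : ∀ {k} (i : Fin k) → ¬ HasBlue (positivityConjunct i)
no-blue-positivity i (zero , ())

-- A suitable colouring with 2k² - 1 white occurrences (k = suc k′)

-- Colour the first step conjunct  g₀(x) < 0 ∨ g₀(x′) < 0 ∨ f₀(x′) < f₀(x) - δ  red, white, blue,
-- and every other conjunct by the standard colouring.  The blue occurrences then lie in
-- pairwise different components ({δ, f_i} and g_1, …, g_(k-1)), and every red occurrence
-- sharing a conjunct with a blue one is in the component of g₀, so G_η has all its edges
-- leaving g₀ and is acyclic.
module OptimalColouring (k′ : ℕ) where

  K : ℕ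
  K = suc k′

  T : Template (RF K) ⊤
  T = rankingTemplate K

  later : Template (RF K) ⊤
  later = drop 2 T

  colouring : Coloring T
  colouring (suc zero , zero)             = red
  colouring (suc zero , suc zero)         = white
  colouring (suc zero , suc (suc zero))   = blue
  colouring (c , p)                       = standardColour (lookup T c) p

  kind-of-later : (c : Fin (length later)) → Kind (lookup later c)
  kind-of-later c = All.lookup (All.tail (All.tail (every-conjunct-kind K))) (∈-lookup c)

  -- Degree: only the first step conjunct loses a white atom compared to the standard colouring.
  white-total : total whites T ≡ 2 * K * K
  white-total = begin
    total whites T
      ≡⟨ template-total K whites ⟩
    0 + (sumFin K (λ _ → sumFin K (λ _ → 2)) + (sumFin K (λ _ → 0) + (whites (coverConjunct K) + 0)))
      ≡⟨ cong₂ (λ a b → 0 + (a + b))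
               (trans (sumFin-cong K (λ _ → sumFin-const K 2)) (sumFin-const K (K * 2)))
               (cong₂ (λ a b → a + (b + 0)) (sumFin-const K 0) (cover-no-white K)) ⟩
    0 + (K * (K * 2) + (K * 0 + (0 + 0)))
      ≡⟨ arithmetic K ⟩
    2 * K * K ∎
    where
    open ≡-Reasoning
    arithmetic : ∀ K → 0 + (K * (K * 2) + (K * 0 + (0 + 0))) ≡ 2 * K * K
    arithmetic = solve-∀

  colouring-degree : deg T colouring ≡ 2 * K * K ∸ 1
  colouring-degree = begin
    deg T colouring                 ≡⟨ sym (m+n∸n≡m (deg T colouring) 1) ⟩
    deg T colouring + 1 ∸ 1         ≡⟨ cong (_∸ 1) (+-comm (deg T colouring) 1) ⟩
    2 + sumFin (length later) (λ c → whites (lookup later c)) ∸ 1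
                                    ≡⟨ cong (λ t → 2 + t ∸ 1) (sumFin-lookup whites later) ⟩
    total whites T ∸ 1              ≡⟨ cong (_∸ 1) white-total ⟩
    2 * K * K ∸ 1 ∎
    where open ≡-Reasoning

  standard-one-red : ∀ {C} → Kind {K} C → Σ (Fin (length C)) λ p →
    standardColour C p ≡ red × (∀ q → standardColour C q ≡ red → q ≡ p)
  standard-one-red delta          = zero , refl , λ { zero _ → refl }
  standard-one-red (step i j)     = suc (suc zero) , refl , λ { zero () ; (suc zero) () ; (suc (suc zero)) _ → refl }
  standard-one-red (positivity i) = zero , refl , λ { zero _ → refl }
  standard-one-red cover          = zero , refl , only-first
    where
    only-first : ∀ q → standardColour (coverConjunct K) q ≡ red → q ≡ zero
    only-first zero    _ = refl
    only-first (suc q) r with trans (sym (cover-colour K (suc q))) r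
    ... | ()

  conditionA : CondA T colouring
  conditionA zero          = standard-one-red delta
  conditionA (suc zero)    = zero , refl , λ { zero _ → refl ; (suc zero) () ; (suc (suc zero)) () }
  conditionA (suc (suc c)) = standard-one-red (kind-of-later c)

  nonzero-if-blue : ∀ {n} (p : Fin n) → colourBy ge n p ≡ blue → toℕ p ≢ 0
  nonzero-if-blue (suc p) _ ()

  standard-blue : ∀ {C} → Kind {K} C → ∀ {p} → standardColour C p ≡ blue → ∀ v → OccursIn v (lookup C p) →
    Σ (Fin K) λ q → component v ≡ suc q × toℕ q ≡ toℕ p × q ≢ zero
  standard-blue delta          {zero}                   ()
  standard-blue (step i j)     {zero}                   ()
  standard-blue (step i j)     {suc zero}               ()
  standard-blue (step i j)     {suc (suc zero)}         ()
  standard-blue (positivity i) {zero}                   ()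
  standard-blue cover          {p} blue-p v occ with cover-atom K (λ i → i) p
  ... | q , atom , pos = q , inside (located-gnonneg q) v (subst (OccursIn v) atom occ) , pos , q≢0
    where
    q≢0 : q ≢ zero
    q≢0 q≡0 = nonzero-if-blue p (trans (sym (cover-colour K p)) blue-p) (trans (sym pos) (cong toℕ q≡0))

  standard-red-beside-blue : ∀ {C} → Kind {K} C → ∀ {p i} → standardColour C p ≡ blue → standardColour C i ≡ red →
    ∀ u → OccursIn u (lookup C i) → component u ≡ suc zero
  standard-red-beside-blue delta          {zero}           ()
  standard-red-beside-blue (step i j)     {zero}           ()
  standard-red-beside-blue (step i j)     {suc zero}       ()
  standard-red-beside-blue (step i j)     {suc (suc zero)} ()
  standard-red-beside-blue (positivity i) {zero}           ()
  standard-red-beside-blue cover {i = zero}  _ _ u occ = inside (located-gnonneg zero) u occ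
  standard-red-beside-blue cover {i = suc i} _ r u occ with trans (sym (cover-colour K (suc i))) r
  ... | ()

  later-blue-unique : AtMostOne HasBlue later
  later-blue-unique = atMostOne-++ (All.tail steps-no-blue) (atMostOne-++ positivity-no-blue single)
    where
    steps-no-blue : All (λ C → ¬ HasBlue C) (stepConjuncts K)
    steps-no-blue = concat⁺ (map⁺ (tabulate⁺ {f = λ i → i} λ i → map⁺ (tabulate⁺ {f = λ j → j} (no-blue-step i))))
    positivity-no-blue : All (λ C → ¬ HasBlue C) (map positivityConjunct (allFin K))
    positivity-no-blue = map⁺ (tabulate⁺ no-blue-positivity)
    single : AtMostOne HasBlue (coverConjunct K ∷ [])
    single zero zero _ _ = refl

  data BlueOccurrence (u : Node (RF K) ⊤) : Occ T → Set where
    decrease : component u ≡ zero → BlueOccurrence u (suc zero , suc (suc zero))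
    in-cover : ∀ c p q → HasBlue (lookup later c) → component u ≡ suc q → toℕ q ≡ toℕ p → q ≢ zero →
               BlueOccurrence u (suc (suc c) , p)

  blue-occurrence : ∀ o → colouring o ≡ blue → ∀ u → OccursIn u (atomAt T o) → BlueOccurrence u o
  blue-occurrence (zero , zero)                   ()
  blue-occurrence (suc zero , zero)               ()
  blue-occurrence (suc zero , suc zero)           ()
  blue-occurrence (suc zero , suc (suc zero)) _ u occ = decrease (inside (located-fdec zero zero) u occ)
  blue-occurrence (suc (suc c) , p)           b u occ with standard-blue (kind-of-later c) b u occ
  ... | q , comp , pos , q≢0 = in-cover c p q (p , b) comp pos q≢0

  blue-outside-g₀ : ∀ {v o} → BlueOccurrence v o → component v ≢ suc zero
  blue-outside-g₀ (decrease comp) e with trans (sym comp) e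
  ... | ()
  blue-outside-g₀ (in-cover c p q _ comp _ q≢0) e = q≢0 (suc-injective (trans (sym comp) e))

  blue-components-differ : ∀ {u v o₁ o₂} → o₁ ≢ o₂ → BlueOccurrence u o₁ → BlueOccurrence v o₂ → component u ≢ component v
  blue-components-differ o₁≢o₂ (decrease _) (decrease _) _ = o₁≢o₂ refl
  blue-components-differ _ (decrease e₁) (in-cover _ _ _ _ e₂ _ _) same with trans (sym e₁) (trans same e₂)
  ... | ()
  blue-components-differ _ (in-cover _ _ _ _ e₁ _ _) (decrease e₂) same with trans (sym e₂) (trans (sym same) e₁)
  ... | ()
  blue-components-differ o₁≢o₂ (in-cover c₁ p₁ q₁ h₁ e₁ t₁ _) (in-cover c₂ p₂ q₂ h₂ e₂ t₂ _) same
    with later-blue-unique c₁ c₂ h₁ h₂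
  ... | refl = o₁≢o₂ (cong (λ p → suc (suc c₁) , p) (toℕ-injective (trans (sym t₁) (trans (cong toℕ q₁≡q₂) t₂))))
    where
    q₁≡q₂ : q₁ ≡ q₂
    q₁≡q₂ = suc-injective (trans (sym e₁) (trans same e₂))

  conditionB : CondB T colouring
  conditionB o₁ o₂ o₁≢o₂ b₁ b₂ u v occ₁ occ₂ path =
    blue-components-differ o₁≢o₂ (blue-occurrence o₁ b₁ u occ₁) (blue-occurrence o₂ b₂ v occ₂)
      (path-preserves-component K path)

  -- Condition (c): every edge of G_η leaves the component of g₀ and enters another one.
  red-beside-blue : ∀ c {i j} → colouring (c , i) ≡ red → colouring (c , j) ≡ blue →
    ∀ u → OccursIn u (atomAt T (c , i)) → component u ≡ suc zero
  red-beside-blue zero          {j = zero}             _ ()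
  red-beside-blue (suc zero)    {zero}                 _ _ u occ = inside (located-gneg zero) u occ
  red-beside-blue (suc zero)    {suc zero}             ()
  red-beside-blue (suc zero)    {suc (suc zero)}       ()
  red-beside-blue (suc (suc c))                        r b u occ = standard-red-beside-blue (kind-of-later c) b r u occ

  conditionC : CondC T colouring
  conditionC = edges-across⇒acyclic (λ u → component u ≡ suc zero) across
    where
    across : ∀ {u v} → ColEdge T colouring u v → component u ≡ suc zero × ¬ component v ≡ suc zero
    across (_ , _ , u~u′ , v~v′ , c , i , j , r , b , occᵤ , occᵥ) =
      trans (path-preserves-component K u~u′) (red-beside-blue c r b _ occᵤ) ,
      λ e → blue-outside-g₀ (blue-occurrence (c , j) b _ occᵥ) (trans (sym (path-preserves-component K v~v′)) e)

  suitable : Suitable T colouring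
  suitable = conditionA , conditionB , conditionC

white-bound : ∀ k d → 3 * k * k + 2 * k + 1 ≤ d + k + (k * k + k + 2) → 2 * k * k ∸ 1 ≤ d
white-bound k d le = subst (2 * k * k ∸ 1 ≤_) (m+n∸n≡m d 1)
  (∸-monoˡ-≤ 1 (+-cancelʳ-≤ (k * k + 2 * k + 1) (2 * k * k) (d + 1)
    (subst₂ _≤_ (split-left k) (split-right k d) le)))
  where
  split-left : ∀ k → 3 * k * k + 2 * k + 1 ≡ 2 * k * k + (k * k + 2 * k + 1)
  split-left = solve-∀
  split-right : ∀ k d → d + k + (k * k + k + 2) ≡ d + 1 + (k * k + 2 * k + 1)
  split-right = solve-∀

lower-bound : ∀ k (η : Coloring (rankingTemplate k)) → Suitable (rankingTemplate k) η →
  2 * k * k ∸ 1 ≤ deg (rankingTemplate k) η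
lower-bound k η suitable = white-bound k (deg T η)
  (subst₂ (λ o l → o ≤ deg T η + k + l) (template-occurrences k) (template-conjuncts k) degree-lower-bound)
  where
  T : Template (RF k) ⊤
  T = rankingTemplate k
  open DegreeLowerBound T component (same-component⇒path k) (λ o → occupant (located k o)) η suitable

lemma6p26 : (k : ℕ) → 1 ≤ k → HasDegree (rankingTemplate k) (2 * k * k ∸ 1)
lemma6p26 (suc k′) _ = (colouring , suitable , colouring-degree) , lower-bound (suc k′)
  where open OptimalColouring k′
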